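{- Fix a finite set $\mathcal{P}$ of predicate symbols and a finite set $\mathcal{C}$ of constant symbols, and let $k$ be a natural number. Then there are only finitely many equivalence classes (up to logical equivalence) of conjunctive set formulas of atoms built from $\mathcal{P}$, $\mathcal{C}$ and variables whose connected width is at most $k$.
   Context: All formulas are function-free first-order formulas. A conjunctive set formula (CSF) of atoms is a finite set $\{a_1,\ldots,a_n\}$ of atoms $a_i=p(t_1,\ldots,t_m)$ (with $p\in\mathcal{P}$ and each term $t_j$ a constant of $\mathcal{C}$ or a variable), interpreted as the conjunction $a_1\wedge\cdots\wedge a_n$ with all its variables existentially quantified. For a CSF $F$, $\mathrm{vars}(F)$ is its set of variables, and the width $\mathrm{width}(F)$ is the number of atoms of $F$ that contain at least one variable. Two variables $u,v$ of $F$ are connected if some atom of $F$ contains both, or (transitively) if there is a variable $z$ of $F$ connected to both. A CSF is connected if all its atoms contain variables and all its variables are connected to each other; an atom containing only constants is also regarded as a connected formula by itself. Every CSF $F$ is partitioned into its connected components $U_1,\ldots,U_n$ (connected CSFs such that variables in different $U_i$ are never connected), and $F$ is the conjunction of them. The connected width of $F$ is $\max_i \mathrm{width}(U_i)$. -}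

module Defs where

open import Data.Nat using (ℕ; _≤_)
open import Data.Fin using (Fin)
open import Data.Vec using (Vec)
import Data.Vec
open import Data.Vec.Membership.Propositional renaming (_∈_ to _∈ᵥ_) using ()
open import Data.List using (List; length)
open import Data.List.Membership.Propositional using (_∈_)
open import Data.List.Relation.Unary.All using (All)
open import Data.List.Relation.Unary.Unique.Propositional using (Unique)
open import Data.Product using (Σ; _×_)
open import Relation.Binary.PropositionalEquality using (_≡_)

module Signature (np : ℕ) (ar : Fin np → ℕ) (nc : ℕ) where

  data Term : Set where
    const : Fin nc → Term
    var   : ℕ → Term

  record Atom : Set where
    constructor atom
    field
      pred : Fin np
      args : Vec Term (ar pred)
  open Atom public

  _∈vars_ : ℕ → Atom → Set
  x ∈vars a = var x ∈ᵥ args a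

  -- A conjunctive set formula: a finite set of atoms, represented as a list
  -- (order and repetitions are semantically and width-wise irrelevant below).
  CSF : Set
  CSF = List Atom

  data VConn (F : CSF) : ℕ → ℕ → Set where
    direct : ∀ {u v a} → a ∈ F → u ∈vars a → v ∈vars a → VConn F u v
    trans  : ∀ {u z v} → VConn F u z → VConn F z v → VConn F u v

  SameComp : CSF → Atom → Atom → Set
  SameComp F a b = Σ ℕ λ x → Σ ℕ λ y → x ∈vars a × y ∈vars b × VConn F x y

  -- connected width of F is at most k: every connected component U of F
  -- has width(U) ≤ k, i.e. every collection of distinct atoms of U
  -- (all of which contain variables) has at most k elements.
  -- Components consisting of a single ground atom have width 0.
  CWidth≤ : CSF → ℕ → Set
  CWidth≤ F k = ∀ a → a ∈ F → (bs : List Atom) → Unique bs →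
                All (λ b → b ∈ F × SameComp F a b) bs → length bs ≤ k

  record Structure : Set₁ where
    field
      Dom    : Set
      interp : (p : Fin np) → Vec Dom (ar p) → Set
      cst    : Fin nc → Dom
  open Structure public

  evalTerm : (M : Structure) → (ℕ → Dom M) → Term → Dom M
  evalTerm M ρ (const c) = cst M c
  evalTerm M ρ (var x)   = ρ x

  HoldsAtom : (M : Structure) → (ℕ → Dom M) → Atom → Set
  HoldsAtom M ρ a = interp M (pred a) (Data.Vec.map (evalTerm M ρ) (args a))

  _⊨_ : Structure → CSF → Set
  M ⊨ F = Σ (ℕ → Dom M) λ ρ → All (HoldsAtom M ρ) F

  _≃_ : CSF → CSF → Set₁
  F ≃ G = (M : Structure) → ((M ⊨ F → M ⊨ G) × (M ⊨ G → M ⊨ F))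

-- A formula F is equivalent to any formula G admitting variable renamings F → G and G → F
-- that map atoms to atoms. Take for G the ground atoms of F together with, for every connected
-- component of F, its "shape": the component with repeated atoms removed and its variables
-- renumbered 0, 1, … in order of occurrence, each distinct shape occurring once, on its own
-- block of variables. Connected width ≤ k bounds a component by k distinct atoms, hence by
-- k · (maximal arity) variables, so all shapes are drawn from one finite list; G is then
-- determined by a subset of the ground atoms and a subset of that list, and there are finitely
-- many such G. Each of them has connected width ≤ k, since its components lie inside single blocks.
module Submission where

open import Data.Empty using (⊥; ⊥-elim)
open import Data.Fin as Fin using (Fin)
import Data.Fin.Properties as Fin
open import Data.List as List
  using (List; []; _∷_; _++_; length; map; filter; concatMap; cartesianProductWith; allFin; deduplicate)
import Data.List.Properties as List
open import Data.List.Extrema.Nat using (max; xs≤max)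
open import Data.List.Membership.Propositional using (_∈_; lose; find)
import Data.List.Membership.DecPropositional as DecMembership
open import Data.List.Membership.Propositional.Properties
import Data.List.Membership.Setoid.Properties as SetoidMembership
open import Data.List.Relation.Binary.Subset.Propositional using (_⊆_)
open import Data.List.Relation.Unary.All as All using (All; []; _∷_)
open import Data.List.Relation.Unary.Any as Any using (Any; here; there)
open import Data.List.Relation.Unary.AllPairs using (_∷_)
open import Data.List.Relation.Unary.Unique.Propositional using (Unique)
open import Data.List.Relation.Unary.Unique.DecPropositional.Properties using (deduplicate-!)
open import Data.Maybe using (Maybe; just; nothing; maybe; fromMaybe)
import Data.Maybe.Properties as Maybe
open import Data.Nat using (ℕ; zero; suc; _+_; _*_; _≤_; _<_; z≤n; s≤s; NonZero)
open import Data.Nat.DivMod using (_/_; _%_; +-distrib-/-∣ʳ; m<n⇒m/n≡0; m*n/n≡m; [m+kn]%n≡m%n; m<n⇒m%n≡m)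
open import Data.Nat.Divisibility using (divides)
open import Data.Nat.Properties
open import Data.Product using (Σ; ∃; _×_; _,_; proj₁; proj₂)
open import Data.Sum using (_⊎_; inj₁; inj₂)
open import Data.Vec as Vec using (Vec; []; _∷_)
import Data.Vec.Properties as VecProp
import Data.Vec.Relation.Unary.Any as VecAny
open import Data.Vec.Membership.Propositional renaming (_∈_ to _∈ᵥ_) using ()
open import Function using (_∘_; id)
open import Relation.Binary.Definitions using (DecidableEquality)
open import Relation.Binary.PropositionalEquality
open import Relation.Nullary using (yes; no; ¬?)
open import Relation.Unary using (Decidable)

open import Defs

module _ {A : Set} where

  lookup-injective : {xs : List A} → Unique xs → ∀ i j → List.lookup xs i ≡ List.lookup xs j → i ≡ j
  lookup-injective (_ ∷ _)  Fin.zero    Fin.zero    _  = refl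
  lookup-injective (x≢ ∷ _) Fin.zero    (Fin.suc j) eq = ⊥-elim (All.lookup x≢ (∈-lookup j) eq)
  lookup-injective (x≢ ∷ _) (Fin.suc i) Fin.zero    eq = ⊥-elim (All.lookup x≢ (∈-lookup i) (sym eq))
  lookup-injective (_ ∷ u)  (Fin.suc i) (Fin.suc j) eq = cong Fin.suc (lookup-injective u i j eq)

  unique-⊆⇒length≤ : {xs ys : List A} → Unique xs → xs ⊆ ys → length xs ≤ length ys
  unique-⊆⇒length≤ {xs} u xs⊆ys = Fin.injective⇒≤ index-injective
    where
    index-injective : ∀ {i j} → Any.index (xs⊆ys (∈-lookup i)) ≡ Any.index (xs⊆ys (∈-lookup j)) → i ≡ j
    index-injective {i} {j} eq = lookup-injective u i j
      (SetoidMembership.index-injective (setoid A) (xs⊆ys (∈-lookup i)) (xs⊆ys (∈-lookup j)) eq)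

  map-cong-∈ᵥ : ∀ {B : Set} {n} {f g : A → B} (v : Vec A n) → (∀ {x} → x ∈ᵥ v → f x ≡ g x) → Vec.map f v ≡ Vec.map g v
  map-cong-∈ᵥ []      _    = refl
  map-cong-∈ᵥ (x ∷ v) f≗g = cong₂ _∷_ (f≗g (VecAny.here refl)) (map-cong-∈ᵥ v (f≗g ∘ VecAny.there))

  ∈ᵥ-map⁻ : ∀ {B : Set} {n} {y : B} (f : A → B) (v : Vec A n) → y ∈ᵥ Vec.map f v → ∃ λ x → x ∈ᵥ v × y ≡ f x
  ∈ᵥ-map⁻ f (x ∷ v) (VecAny.here y≡fx) = x , VecAny.here refl , y≡fx
  ∈ᵥ-map⁻ f (x ∷ v) (VecAny.there y∈) with ∈ᵥ-map⁻ f v y∈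
  ... | x′ , x′∈v , y≡fx′ = x′ , VecAny.there x′∈v , y≡fx′

  sublists : List A → List (List A)
  sublists []       = [] ∷ []
  sublists (x ∷ xs) = map (x ∷_) (sublists xs) ++ sublists xs

  filter∈sublists : {P : A → Set} (P? : Decidable P) (xs : List A) → filter P? xs ∈ sublists xs
  filter∈sublists P? []       = here refl
  filter∈sublists P? (x ∷ xs) with P? x
  ... | yes _ = ∈-++⁺ˡ (∈-map⁺ (x ∷_) (filter∈sublists P? xs))
  ... | no  _ = ∈-++⁺ʳ _ (filter∈sublists P? xs)

  ∈-sublists⇒⊆ : (xs : List A) {ys : List A} → ys ∈ sublists xs → ys ⊆ xs
  ∈-sublists⇒⊆ [] (here refl) ()
  ∈-sublists⇒⊆ (x ∷ xs) ys∈ y∈ys with ∈-++⁻ (map (x ∷_) (sublists xs)) ys∈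
  ... | inj₂ ys∈′ = there (∈-sublists⇒⊆ xs ys∈′ y∈ys)
  ... | inj₁ ys∈′ with ∈-map⁻ (x ∷_) ys∈′
  ... | zs , zs∈ , refl with y∈ys
  ... | here y≡x = here y≡x
  ... | there y∈zs = there (∈-sublists⇒⊆ xs zs∈ y∈zs)

  listsOfLength≤ : ℕ → List A → List (List A)
  listsOfLength≤ zero    xs = [] ∷ []
  listsOfLength≤ (suc k) xs = [] ∷ cartesianProductWith _∷_ xs (listsOfLength≤ k xs)

  ∈-listsOfLength≤⁺ : ∀ k {xs ys : List A} → ys ⊆ xs → length ys ≤ k → ys ∈ listsOfLength≤ k xs
  ∈-listsOfLength≤⁺ zero    {ys = []}     _     _         = here refl
  ∈-listsOfLength≤⁺ (suc k) {ys = []}     _     _         = here refl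
  ∈-listsOfLength≤⁺ (suc k) {ys = y ∷ ys} ys⊆xs (s≤s len) =
    there (∈-cartesianProductWith⁺ _∷_ (ys⊆xs (here refl)) (∈-listsOfLength≤⁺ k (ys⊆xs ∘ there) len))

  ∈-listsOfLength≤⁻ : ∀ k (xs : List A) {ys : List A} → ys ∈ listsOfLength≤ k xs → length ys ≤ k × ys ⊆ xs
  ∈-listsOfLength≤⁻ zero    xs (here refl) = z≤n , λ ()
  ∈-listsOfLength≤⁻ (suc k) xs (here refl) = z≤n , λ ()
  ∈-listsOfLength≤⁻ (suc k) xs (there ys∈) with ∈-cartesianProductWith⁻ _∷_ xs (listsOfLength≤ k xs) ys∈
  ... | y , ys , y∈xs , ys∈′ , refl with ∈-listsOfLength≤⁻ k xs ys∈′
  ... | len , ys⊆xs = s≤s len , λ { (here refl) → y∈xs ; (there z∈ys) → ys⊆xs z∈ys }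

  vectorsOver : ∀ n → List A → List (Vec A n)
  vectorsOver zero    xs = [] ∷ []
  vectorsOver (suc n) xs = cartesianProductWith _∷_ xs (vectorsOver n xs)

  ∈-vectorsOver⁺ : ∀ {n} {xs : List A} (v : Vec A n) → (∀ {x} → x ∈ᵥ v → x ∈ xs) → v ∈ vectorsOver n xs
  ∈-vectorsOver⁺ []      _     = here refl
  ∈-vectorsOver⁺ (x ∷ v) v⊆xs =
    ∈-cartesianProductWith⁺ _∷_ (v⊆xs (VecAny.here refl)) (∈-vectorsOver⁺ v (v⊆xs ∘ VecAny.there))

  ∈-vectorsOver⁻ : ∀ {n} (xs : List A) {v : Vec A n} {x : A} → v ∈ vectorsOver n xs → x ∈ᵥ v → x ∈ xs
  ∈-vectorsOver⁻ {suc n} xs v∈ x∈v with ∈-cartesianProductWith⁻ _∷_ xs (vectorsOver n xs) v∈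
  ... | y , v′ , y∈xs , v′∈ , refl with x∈v
  ... | VecAny.here refl = y∈xs
  ... | VecAny.there x∈v′ = ∈-vectorsOver⁻ xs v′∈ x∈v′

module Position {A : Set} (_≟_ : DecidableEquality A) where

  position : A → List A → ℕ
  position x []       = 0
  position x (y ∷ ys) with x ≟ y
  ... | yes _ = 0
  ... | no  _ = suc (position x ys)

  position< : ∀ {x} xs → x ∈ xs → position x xs < length xs
  position< {x} (y ∷ ys) x∈ with x ≟ y | x∈
  ... | yes _   | _          = s≤s z≤n
  ... | no  x≢y | here x≡y   = ⊥-elim (x≢y x≡y)
  ... | no  _   | there x∈ys = s≤s (position< ys x∈ys)

  head-drop-position : ∀ {x} xs → x ∈ xs → List.head (List.drop (position x xs) xs) ≡ just x
  head-drop-position {x} (y ∷ ys) x∈ with x ≟ y | x∈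
  ... | yes refl | _          = refl
  ... | no  x≢y  | here x≡y   = ⊥-elim (x≢y x≡y)
  ... | no  _    | there x∈ys = head-drop-position ys x∈ys

  position-injective : ∀ {x y xs} → x ∈ xs → y ∈ xs → position x xs ≡ position y xs → x ≡ y
  position-injective {xs = xs} x∈ y∈ eq = Maybe.just-injective (begin
    just _                                       ≡⟨ head-drop-position xs x∈ ⟨
    List.head (List.drop (position _ xs) xs)     ≡⟨ cong (λ i → List.head (List.drop i xs)) eq ⟩
    List.head (List.drop (position _ xs) xs)     ≡⟨ head-drop-position xs y∈ ⟩
    just _                                       ∎)
    where open ≡-Reasoning

module _ {B : ℕ} .{{_ : NonZero B}} where

  [i+pB]/B≡p : ∀ {i} p → i < B → (i + p * B) / B ≡ p
  [i+pB]/B≡p {i} p i<B = trans (+-distrib-/-∣ʳ i (divides p refl)) (cong₂ _+_ (m<n⇒m/n≡0 i<B) (m*n/n≡m p B))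

  [i+pB]%B≡i : ∀ {i} p → i < B → (i + p * B) % B ≡ i
  [i+pB]%B≡i {i} p i<B = trans ([m+kn]%n≡m%n i p B) (m<n⇒m%n≡m i<B)

module Syntax (np : ℕ) (ar : Fin np → ℕ) (nc : ℕ) where
  open Signature np ar nc hiding (trans)
  open Position _≟_ using (position; position<; head-drop-position)

  _≟ᵗ_ : DecidableEquality Term
  const c ≟ᵗ const d with c Fin.≟ d
  ... | yes refl = yes refl
  ... | no  c≢d  = no λ { refl → c≢d refl }
  const _ ≟ᵗ var _   = no λ ()
  var _   ≟ᵗ const _ = no λ ()
  var x   ≟ᵗ var y with x ≟ y
  ... | yes refl = yes refl
  ... | no  x≢y  = no λ { refl → x≢y refl }

  _≟ᵃ_ : DecidableEquality Atom
  atom p ts ≟ᵃ atom q us with p Fin.≟ q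
  ... | no  p≢q  = no λ { refl → p≢q refl }
  ... | yes refl with VecProp.≡-dec _≟ᵗ_ ts us
  ... | yes refl  = yes refl
  ... | no  ts≢us = no λ { refl → ts≢us refl }

  varsᵛ : ∀ {n} → Vec Term n → List ℕ
  varsᵛ []             = []
  varsᵛ (const _ ∷ ts) = varsᵛ ts
  varsᵛ (var y ∷ ts)   = y ∷ varsᵛ ts

  ∈-varsᵛ⁺ : ∀ {n y} (ts : Vec Term n) → var y ∈ᵥ ts → y ∈ varsᵛ ts
  ∈-varsᵛ⁺ (const _ ∷ ts) (VecAny.there y∈) = ∈-varsᵛ⁺ ts y∈
  ∈-varsᵛ⁺ (var _ ∷ ts)   (VecAny.here refl) = here refl
  ∈-varsᵛ⁺ (var _ ∷ ts)   (VecAny.there y∈) = there (∈-varsᵛ⁺ ts y∈)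

  ∈-varsᵛ⁻ : ∀ {n y} (ts : Vec Term n) → y ∈ varsᵛ ts → var y ∈ᵥ ts
  ∈-varsᵛ⁻ (const _ ∷ ts) y∈         = VecAny.there (∈-varsᵛ⁻ ts y∈)
  ∈-varsᵛ⁻ (var _ ∷ ts)   (here refl) = VecAny.here refl
  ∈-varsᵛ⁻ (var _ ∷ ts)   (there y∈)  = VecAny.there (∈-varsᵛ⁻ ts y∈)

  length-varsᵛ : ∀ {n} (ts : Vec Term n) → length (varsᵛ ts) ≤ n
  length-varsᵛ []             = z≤n
  length-varsᵛ (const _ ∷ ts) = m≤n⇒m≤1+n (length-varsᵛ ts)
  length-varsᵛ (var _ ∷ ts)   = s≤s (length-varsᵛ ts)

  vars : Atom → List ℕ
  vars a = varsᵛ (args a)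

  varsᶠ : CSF → List ℕ
  varsᶠ = concatMap vars

  ∈-varsᶠ⁺ : ∀ {y a F} → a ∈ F → y ∈vars a → y ∈ varsᶠ F
  ∈-varsᶠ⁺ {a = a} a∈F y∈a = ∈-concatMap⁺ vars (lose a∈F (∈-varsᵛ⁺ (args a) y∈a))

  ∈-varsᶠ⁻ : ∀ {y} F → y ∈ varsᶠ F → ∃ λ a → a ∈ F × y ∈vars a
  ∈-varsᶠ⁻ F y∈ with find (∈-concatMap⁻ vars y∈)
  ... | a , a∈F , y∈a = a , a∈F , ∈-varsᵛ⁻ (args a) y∈a

  HasVar : Atom → Set
  HasVar a = ∃ (_∈ vars a)

  hasVar? : Decidable HasVar
  hasVar? a with vars a
  ... | []    = no λ ()
  ... | y ∷ _ = yes (y , here refl)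

  variableIndex : CSF → ℕ → ℕ
  variableIndex D x = position x (varsᶠ D)

  variableIndex< : ∀ {x} D → x ∈ varsᶠ D → variableIndex D x < length (varsᶠ D)
  variableIndex< D = position< (varsᶠ D)

  variableAt : CSF → ℕ → ℕ
  variableAt D i = fromMaybe 0 (List.head (List.drop i (varsᶠ D)))

  variableAt-variableIndex : ∀ {x} D → x ∈ varsᶠ D → variableAt D (variableIndex D x) ≡ x
  variableAt-variableIndex D x∈ = cong (fromMaybe 0) (head-drop-position (varsᶠ D) x∈)

  renameᵗ : (ℕ → ℕ) → Term → Term
  renameᵗ f (const c) = const c
  renameᵗ f (var x)   = var (f x)

  rename : (ℕ → ℕ) → Atom → Atom
  rename f (atom p ts) = atom p (Vec.map (renameᵗ f) ts)

  rename-cong : ∀ {f g} a → (∀ {y} → y ∈vars a → f y ≡ g y) → rename f a ≡ rename g a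
  rename-cong {f} {g} (atom p ts) f≗g = cong (atom p) (map-cong-∈ᵥ ts renameᵗ-cong)
    where
    renameᵗ-cong : ∀ {t} → t ∈ᵥ ts → renameᵗ f t ≡ renameᵗ g t
    renameᵗ-cong {const _} _   = refl
    renameᵗ-cong {var _}   y∈a = cong var (f≗g y∈a)

  renameᵗ-∘ : ∀ f g → renameᵗ f ∘ renameᵗ g ≗ renameᵗ (f ∘ g)
  renameᵗ-∘ f g (const _) = refl
  renameᵗ-∘ f g (var _)   = refl

  renameᵗ-id : renameᵗ id ≗ id
  renameᵗ-id (const _) = refl
  renameᵗ-id (var _)   = refl

  rename-∘ : ∀ f g a → rename f (rename g a) ≡ rename (f ∘ g) a
  rename-∘ f g (atom p ts) =
    cong (atom p) (trans (sym (VecProp.map-∘ (renameᵗ f) (renameᵗ g) ts)) (VecProp.map-cong (renameᵗ-∘ f g) ts))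

  rename-id : ∀ a → rename id a ≡ a
  rename-id (atom p ts) = cong (atom p) (trans (VecProp.map-cong renameᵗ-id ts) (VecProp.map-id ts))

  rename-fixing : ∀ {f} a → (∀ {x} → x ∈vars a → f x ≡ x) → rename f a ≡ a
  rename-fixing a f-fixes = trans (rename-cong a f-fixes) (rename-id a)

  ∈vars-rename⁻ : ∀ {y} f a → y ∈vars rename f a → ∃ λ x → x ∈vars a × y ≡ f x
  ∈vars-rename⁻ f (atom p ts) y∈ with ∈ᵥ-map⁻ (renameᵗ f) ts y∈
  ... | var x , x∈a , refl = x , x∈a , refl

  Homomorphism : (ℕ → ℕ) → CSF → CSF → Set
  Homomorphism f F G = ∀ {a} → a ∈ F → rename f a ∈ G

  evalTerm-renameᵗ : ∀ M ρ f → evalTerm M ρ ∘ renameᵗ f ≗ evalTerm M (ρ ∘ f)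
  evalTerm-renameᵗ M ρ f (const _) = refl
  evalTerm-renameᵗ M ρ f (var _)   = refl

  holds-rename : ∀ M ρ f a → HoldsAtom M ρ (rename f a) → HoldsAtom M (ρ ∘ f) a
  holds-rename M ρ f (atom p ts) = subst (interp M p) (begin
    Vec.map (evalTerm M ρ) (Vec.map (renameᵗ f) ts)  ≡⟨ VecProp.map-∘ (evalTerm M ρ) (renameᵗ f) ts ⟨
    Vec.map (evalTerm M ρ ∘ renameᵗ f) ts           ≡⟨ VecProp.map-cong (evalTerm-renameᵗ M ρ f) ts ⟩
    Vec.map (evalTerm M (ρ ∘ f)) ts                 ∎)
    where open ≡-Reasoning

  homomorphism⇒⊨ : ∀ {f F G} → Homomorphism f F G → ∀ M → M ⊨ G → M ⊨ F
  homomorphism⇒⊨ {f} hom M (ρ , G-holds) =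
    ρ ∘ f , All.tabulate (λ {a} a∈F → holds-rename M ρ f a (All.lookup G-holds (hom a∈F)))

  homomorphic-equivalence : ∀ {f g F G} → Homomorphism f F G → Homomorphism g G F → F ≃ G
  homomorphic-equivalence F→G G→F M = homomorphism⇒⊨ G→F M , homomorphism⇒⊨ F→G M

module Components (np : ℕ) (ar : Fin np → ℕ) (nc : ℕ) where
  open Signature np ar nc hiding (trans)
  open Syntax np ar nc
  open DecMembership _≟_ using (_∈?_)

  VConn-sym : ∀ {F x y} → VConn F x y → VConn F y x
  VConn-sym (direct a∈F x∈a y∈a) = direct a∈F y∈a x∈a
  VConn-sym (VConn.trans p q)    = VConn.trans (VConn-sym q) (VConn-sym p)

  VConn-mono : ∀ {F G x y} → F ⊆ G → VConn F x y → VConn G x y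
  VConn-mono F⊆G (direct a∈F x∈a y∈a) = direct (F⊆G a∈F) x∈a y∈a
  VConn-mono F⊆G (VConn.trans p q)    = VConn.trans (VConn-mono F⊆G p) (VConn-mono F⊆G q)

  SharesVar : Atom → CSF → Set
  SharesVar a C = Any (_∈ varsᶠ C) (vars a)

  sharesVar? : ∀ a → Decidable (SharesVar a)
  sharesVar? a C = Any.any? (λ y → y ∈? varsᶠ C) (vars a)

  merged : Atom → List CSF → CSF
  merged a cs = a ∷ List.concat (filter (sharesVar? a) cs)

  untouched : Atom → List CSF → List CSF
  untouched a cs = filter (¬? ∘ sharesVar? a) cs

  components : CSF → List CSF
  components []      = []
  components (a ∷ F) = merged a (components F) ∷ untouched a (components F)

  ∈-merged⁻ : ∀ {a b cs} → b ∈ merged a cs → b ≡ a ⊎ ∃ λ C → C ∈ cs × SharesVar a C × b ∈ C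
  ∈-merged⁻                (here b≡a) = inj₁ b≡a
  ∈-merged⁻ {a} {cs = cs} (there b∈) with ∈-concat⁻′ (filter (sharesVar? a) cs) b∈
  ... | C , b∈C , C∈ with ∈-filter⁻ (sharesVar? a) {xs = cs} C∈
  ... | C∈cs , shares = inj₂ (C , C∈cs , shares , b∈C)

  components-⊆ : ∀ F {C} → C ∈ components F → C ⊆ F
  components-⊆ (a ∷ F) (here refl) b∈ with ∈-merged⁻ b∈
  ... | inj₁ refl                  = here refl
  ... | inj₂ (C , C∈ , _ , b∈C)    = there (components-⊆ F C∈ b∈C)
  components-⊆ (a ∷ F) (there C∈) b∈ =
    there (components-⊆ F (proj₁ (∈-filter⁻ (¬? ∘ sharesVar? a) {xs = components F} C∈)) b∈)

  components-cover : ∀ F {b} → b ∈ F → ∃ λ C → C ∈ components F × b ∈ C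
  components-cover (a ∷ F) (here refl) = _ , here refl , here refl
  components-cover (a ∷ F) (there b∈F) with components-cover F b∈F
  ... | C , C∈ , b∈C with sharesVar? a C
  ... | yes shares = _ , here refl , there (∈-concat⁺′ b∈C (∈-filter⁺ (sharesVar? a) C∈ shares))
  ... | no ¬shares = C , there (∈-filter⁺ (¬? ∘ sharesVar? a) C∈ ¬shares) , b∈C

  components-disjoint : ∀ F {C D b c y} → C ∈ components F → D ∈ components F →
                        b ∈ C → c ∈ D → y ∈vars b → y ∈vars c → C ≡ D
  merged-untouched-apart : ∀ F {a D b c y} → D ∈ untouched a (components F) → b ∈ merged a (components F) →
                           c ∈ D → y ∈vars b → y ∈vars c → ⊥

  components-disjoint (a ∷ F) (here refl) (here refl) _ _ _ _ = refl
  components-disjoint (a ∷ F) (here refl) (there D∈) b∈ c∈ y∈b y∈c =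
    ⊥-elim (merged-untouched-apart F D∈ b∈ c∈ y∈b y∈c)
  components-disjoint (a ∷ F) (there C∈) (here refl) b∈ c∈ y∈b y∈c =
    ⊥-elim (merged-untouched-apart F C∈ c∈ b∈ y∈c y∈b)
  components-disjoint (a ∷ F) (there C∈) (there D∈) =
    components-disjoint F (proj₁ (∈-filter⁻ (¬? ∘ sharesVar? a) {xs = components F} C∈))
                          (proj₁ (∈-filter⁻ (¬? ∘ sharesVar? a) {xs = components F} D∈))

  merged-untouched-apart F {a} D∈ b∈ c∈D y∈b y∈c
    with ∈-filter⁻ (¬? ∘ sharesVar? a) {xs = components F} D∈ | ∈-merged⁻ b∈
  ... | _    , ¬shares | inj₁ refl = ¬shares (lose (∈-varsᵛ⁺ (args a) y∈b) (∈-varsᶠ⁺ c∈D y∈c))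
  ... | D∈cs , ¬shares | inj₂ (C , C∈ , shares , b∈C) =
    ¬shares (subst (SharesVar a) (components-disjoint F C∈ D∈cs b∈C c∈D y∈b y∈c) shares)

  components-connected : ∀ F {C b c x y} → C ∈ components F → b ∈ C → c ∈ C →
                         x ∈vars b → y ∈vars c → VConn F x y
  components-connected (a ∷ F) (here refl) b∈ c∈ x∈b y∈c with linked-to-a b∈ x∈b | linked-to-a c∈ y∈c
    where
    linked-to-a : ∀ {b x} → b ∈ merged a (components F) → x ∈vars b → ∃ λ w → w ∈vars a × VConn (a ∷ F) x w
    linked-to-a b∈ x∈b with ∈-merged⁻ b∈
    ... | inj₁ refl = _ , x∈b , direct (here refl) x∈b x∈b
    ... | inj₂ (C , C∈ , shares , b∈C) with find shares
    ... | w , w∈a , w∈C with ∈-varsᶠ⁻ C w∈C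
    ... | e , e∈C , w∈e = w , ∈-varsᵛ⁻ (args a) w∈a , VConn-mono there (components-connected F C∈ b∈C e∈C x∈b w∈e)
  ... | v , v∈a , x~v | w , w∈a , y~w = VConn.trans (VConn.trans x~v (direct (here refl) v∈a w∈a)) (VConn-sym y~w)
  components-connected (a ∷ F) (there C∈) b∈ c∈ x∈b y∈c = VConn-mono there
    (components-connected F (proj₁ (∈-filter⁻ (¬? ∘ sharesVar? a) {xs = components F} C∈)) b∈ c∈ x∈b y∈c)

module Enumeration (np : ℕ) (ar : Fin np → ℕ) (nc : ℕ) where
  open Signature np ar nc hiding (trans)

  termsBelow : ℕ → List Term
  termsBelow b = map const (allFin nc) ++ map var (List.upTo b)

  ∈-termsBelow⁺ : ∀ {b} t → (∀ {y} → t ≡ var y → y < b) → t ∈ termsBelow b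
  ∈-termsBelow⁺ (const c) _   = ∈-++⁺ˡ (∈-map⁺ const (∈-allFin c))
  ∈-termsBelow⁺ (var y)   y<b = ∈-++⁺ʳ _ (∈-map⁺ var (∈-upTo⁺ (y<b refl)))

  ∈-termsBelow⁻ : ∀ {b y} → var y ∈ termsBelow b → y < b
  ∈-termsBelow⁻ {b} y∈ with ∈-++⁻ (map const (allFin nc)) y∈
  ... | inj₁ y∈consts with ∈-map⁻ const y∈consts
  ...   | _ , _ , ()
  ∈-termsBelow⁻ {b} y∈ | inj₂ y∈vars with ∈-map⁻ var y∈vars
  ...   | _ , y∈upTo , refl = ∈-upTo⁻ y∈upTo

  atomsWithPredicate : ℕ → Fin np → List Atom
  atomsWithPredicate b p = map (atom p) (vectorsOver (ar p) (termsBelow b))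

  atomsBelow : ℕ → List Atom
  atomsBelow b = concatMap (atomsWithPredicate b) (allFin np)

  ∈-atomsBelow⁺ : ∀ {b} a → (∀ {y} → y ∈vars a → y < b) → a ∈ atomsBelow b
  ∈-atomsBelow⁺ (atom p ts) vars<b = ∈-concatMap⁺ _ (lose (∈-allFin p) (∈-map⁺ (atom p)
    (∈-vectorsOver⁺ ts λ {t} t∈ts → ∈-termsBelow⁺ t λ { refl → vars<b t∈ts })))

  ∈-atomsBelow⁻ : ∀ {b a y} → a ∈ atomsBelow b → y ∈vars a → y < b
  ∈-atomsBelow⁻ {b} a∈ y∈a with find (∈-concatMap⁻ (atomsWithPredicate b) {xs = allFin np} a∈)
  ... | p , _ , a∈p with ∈-map⁻ (atom p) a∈p
  ... | ts , ts∈ , refl = ∈-termsBelow⁻ (∈-vectorsOver⁻ (termsBelow b) ts∈ y∈a)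

module NormalForm (np : ℕ) (ar : Fin np → ℕ) (nc : ℕ) (k : ℕ) where
  open Signature np ar nc hiding (trans)
  open Syntax np ar nc
  open Enumeration np ar nc
  open Components np ar nc
  open Position (List.≡-dec _≟ᵃ_) using (position; head-drop-position; position-injective)
  open DecMembership (List.≡-dec _≟ᵃ_) using () renaming (_∈?_ to _∈ˢ?_)
  open DecMembership _≟ᵃ_ using () renaming (_∈?_ to _∈ᵃ?_)
  open DecMembership _≟_ using () renaming (_∈?_ to _∈ᵛ?_)

  maxArity : ℕ
  maxArity = max 0 (map ar (allFin np))

  arity≤maxArity : ∀ p → ar p ≤ maxArity
  arity≤maxArity p = All.lookup (xs≤max 0 (map ar (allFin np))) (∈-map⁺ ar (∈-allFin p))

  length-varsᶠ : ∀ D → length (varsᶠ D) ≤ length D * maxArity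
  length-varsᶠ []      = z≤n
  length-varsᶠ (a ∷ D) = begin
    length (vars a ++ varsᶠ D)              ≡⟨ List.length-++ (vars a) ⟩
    length (vars a) + length (varsᶠ D)      ≤⟨ +-mono-≤ (≤-trans (length-varsᵛ (args a)) (arity≤maxArity (pred a)))
                                                        (length-varsᶠ D) ⟩
    maxArity + length D * maxArity          ∎
    where open ≤-Reasoning

  -- exceeds the number of variables of a component with at most k distinct atoms
  blockSize : ℕ
  blockSize = suc (k * maxArity)

  shapes : List (List Atom)
  shapes = listsOfLength≤ k (atomsBelow blockSize)

  groundAtoms : List Atom
  groundAtoms = atomsBelow 0

  -- The shape at position p of shapes owns the variables p · blockSize + i for i < blockSize,
  -- so blocks of distinct shapes share no variable.
  shift : List Atom → ℕ → ℕ
  shift S i = i + position S shapes * blockSize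

  block : List Atom → CSF
  block S = map (rename (shift S)) S

  assemble : List Atom → List (List Atom) → CSF
  assemble gs T = gs ++ concatMap block T

  candidates : List CSF
  candidates = cartesianProductWith assemble (sublists groundAtoms) (sublists shapes)

  ∈vars-block⇒/ : ∀ {S b z} → S ∈ shapes → b ∈ block S → z ∈vars b → z / blockSize ≡ position S shapes
  ∈vars-block⇒/ {S} S∈ b∈ z∈b with ∈-map⁻ (rename (shift S)) b∈
  ... | s , s∈S , refl with ∈vars-rename⁻ (shift S) s z∈b
  ... | x , x∈s , refl =
    [i+pB]/B≡p (position S shapes) (∈-atomsBelow⁻ (proj₂ (∈-listsOfLength≤⁻ k _ S∈) s∈S) x∈s)

  module _ {gs T} (gs⊆groundAtoms : gs ⊆ groundAtoms) (T⊆shapes : T ⊆ shapes) where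

    blockOf : ∀ {b y} → b ∈ assemble gs T → y ∈vars b → ∃ λ S → S ∈ shapes × b ∈ block S
    blockOf b∈ y∈b with ∈-++⁻ gs b∈
    ... | inj₁ b∈gs with () ← ∈-atomsBelow⁻ (gs⊆groundAtoms b∈gs) y∈b
    ... | inj₂ b∈blocks with find (∈-concatMap⁻ block {xs = T} b∈blocks)
    ...   | S , S∈T , b∈S = S , T⊆shapes S∈T , b∈S

    VConn⇒same-block : ∀ {u v} → VConn (assemble gs T) u v → u / blockSize ≡ v / blockSize
    VConn⇒same-block (direct b∈ u∈b v∈b) with blockOf b∈ u∈b
    ... | S , S∈ , b∈S = trans (∈vars-block⇒/ S∈ b∈S u∈b) (sym (∈vars-block⇒/ S∈ b∈S v∈b))
    VConn⇒same-block (VConn.trans p q) = trans (VConn⇒same-block p) (VConn⇒same-block q)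

    assemble-cwidth : CWidth≤ (assemble gs T) k
    assemble-cwidth a a∈ []            _      _    = z≤n
    assemble-cwidth a a∈ bs@(_ ∷ _) unique comp with All.head comp
    ... | _ , x , _ , x∈a , _ with blockOf a∈ x∈a
    ... | S , S∈ , a∈S = begin
      length bs         ≤⟨ unique-⊆⇒length≤ unique bs⊆block ⟩
      length (block S)  ≡⟨ List.length-map (rename (shift S)) S ⟩
      length S          ≤⟨ proj₁ (∈-listsOfLength≤⁻ k _ S∈) ⟩
      k                 ∎
      where
      open ≤-Reasoning
      bs⊆block : bs ⊆ block S
      bs⊆block b∈bs with All.lookup comp b∈bs
      ... | b∈G , x′ , y , x′∈a , y∈b , x′~y with blockOf b∈G y∈b
      ... | S′ , S′∈ , b∈S′ = subst (λ R → _ ∈ block R) (sym S≡S′) b∈S′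
        where
        S≡S′ : S ≡ S′
        S≡S′ = position-injective S∈ S′∈ (begin-equality
          position S shapes   ≡⟨ ∈vars-block⇒/ S∈ a∈S x′∈a ⟨
          x′ / blockSize      ≡⟨ VConn⇒same-block x′~y ⟩
          y / blockSize       ≡⟨ ∈vars-block⇒/ S′∈ b∈S′ y∈b ⟩
          position S′ shapes  ∎)

  candidates-cwidth : All (λ G → CWidth≤ G k) candidates
  candidates-cwidth = All.tabulate λ G∈ →
    let gs , T , gs∈ , T∈ , G≡ = ∈-cartesianProductWith⁻ assemble (sublists groundAtoms) (sublists shapes) G∈
    in subst (λ G → CWidth≤ G k) (sym G≡)
             (assemble-cwidth (∈-sublists⇒⊆ groundAtoms gs∈) (∈-sublists⇒⊆ shapes T∈))

  module Canonical (F : CSF) where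

    -- Ground atoms are components of their own and go into the normal form unchanged.
    varAtoms : CSF
    varAtoms = filter hasVar? F

    comps : List CSF
    comps = components varAtoms

    distinct : CSF → CSF
    distinct = deduplicate _≟ᵃ_

    relabel : CSF → ℕ → ℕ
    relabel C = variableIndex (distinct C)

    shapeOf : CSF → List Atom
    shapeOf C = map (rename (relabel C)) (distinct C)

    shapesOf : List (List Atom)
    shapesOf = filter (_∈ˢ? map shapeOf comps) shapes

    groundPart : List Atom
    groundPart = filter (_∈ᵃ? F) groundAtoms

    normalForm : CSF
    normalForm = assemble groundPart shapesOf

    normalForm∈candidates : normalForm ∈ candidates
    normalForm∈candidates = ∈-cartesianProductWith⁺ assemble
      (filter∈sublists (_∈ᵃ? F) groundAtoms) (filter∈sublists (_∈ˢ? map shapeOf comps) shapes)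

    toNormalForm : ℕ → ℕ
    toNormalForm y with Any.any? (λ C → y ∈ᵛ? varsᶠ C) comps
    ... | yes y∈some = let C , _ = find y∈some in shift (shapeOf C) (relabel C y)
    ... | no  _      = 0  -- y is not a variable of F

    toNormalForm-component : ∀ {C y} → C ∈ comps → y ∈ varsᶠ C → toNormalForm y ≡ shift (shapeOf C) (relabel C y)
    toNormalForm-component {C} {y} C∈ y∈C with Any.any? (λ C → y ∈ᵛ? varsᶠ C) comps
    ... | no  y∉all     = ⊥-elim (y∉all (lose C∈ y∈C))
    ... | yes y∈some with find y∈some
    ...   | D , D∈ , y∈D with ∈-varsᶠ⁻ D y∈D | ∈-varsᶠ⁻ C y∈C
    ...     | b , b∈D , y∈b | c , c∈C , y∈c
              rewrite components-disjoint varAtoms D∈ C∈ b∈D c∈C y∈b y∈c = refl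

    -- Distinct components may share a shape; the variables of its block are read off this one.
    representative : List Atom → Maybe CSF
    representative S with Any.any? (λ C → List.≡-dec _≟ᵃ_ (shapeOf C) S) comps
    ... | yes found = just (proj₁ (find found))
    ... | no  _     = nothing

    representative-sound : ∀ {S C} → representative S ≡ just C → C ∈ comps × shapeOf C ≡ S
    representative-sound {S} eq with Any.any? (λ C → List.≡-dec _≟ᵃ_ (shapeOf C) S) comps
    representative-sound refl | yes found = proj₂ (find found)

    representative-complete : ∀ {S} → S ∈ map shapeOf comps → ∃ λ C → representative S ≡ just C
    representative-complete {S} S∈ with Any.any? (λ C → List.≡-dec _≟ᵃ_ (shapeOf C) S) comps
    ... | yes found = _ , refl
    ... | no  none  = let C , C∈ , S≡ = ∈-map⁻ shapeOf S∈ in ⊥-elim (none (lose C∈ (sym S≡)))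

    decode : List Atom → ℕ → ℕ
    decode S i = maybe (λ C → variableAt (distinct C) i) 0 (representative S)

    fromNormalForm : ℕ → ℕ
    fromNormalForm n = maybe (λ S → decode S (n % blockSize)) 0 (List.head (List.drop (n / blockSize) shapes))

    fromNormalForm-shift : ∀ {S i} → S ∈ shapes → i < blockSize → fromNormalForm (shift S i) ≡ decode S i
    fromNormalForm-shift {S} S∈ i<B
      rewrite [i+pB]/B≡p (position S shapes) i<B | head-drop-position shapes S∈
            | [i+pB]%B≡i (position S shapes) i<B = refl

    ∈-varAtoms⁻ : ∀ {a} → a ∈ varAtoms → a ∈ F × ∃ (_∈vars a)
    ∈-varAtoms⁻ {a} a∈ with ∈-filter⁻ hasVar? {xs = F} a∈
    ... | a∈F , y , y∈a = a∈F , y , ∈-varsᵛ⁻ (args a) y∈a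

    distinct⊆component : ∀ C → distinct C ⊆ C
    distinct⊆component C = ∈-deduplicate⁻ _≟ᵃ_ C

    module _ (F-cwidth : CWidth≤ F k) where

      unique⊆component⇒length≤k : ∀ {C D} → C ∈ comps → Unique D → D ⊆ C → length D ≤ k
      unique⊆component⇒length≤k {D = []}    _  _      _   = z≤n
      unique⊆component⇒length≤k {D = d ∷ D} C∈ unique D⊆C with ∈-varAtoms⁻ (components-⊆ varAtoms C∈ (D⊆C (here refl)))
      ... | d∈F , x , x∈d = F-cwidth d d∈F (d ∷ D) unique (All.tabulate λ {b} b∈ →
        let b∈varAtoms = components-⊆ varAtoms C∈ (D⊆C b∈)
            b∈F , y , y∈b = ∈-varAtoms⁻ b∈varAtoms
        in b∈F , x , y , x∈d , y∈b ,
           VConn-mono (proj₁ ∘ ∈-varAtoms⁻) (components-connected varAtoms C∈ (D⊆C (here refl)) (D⊆C b∈) x∈d y∈b))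

      length-distinct≤k : ∀ {C} → C ∈ comps → length (distinct C) ≤ k
      length-distinct≤k {C} C∈ = unique⊆component⇒length≤k C∈ (deduplicate-! _≟ᵃ_ C) (distinct⊆component C)

      relabel<blockSize : ∀ {C x} → C ∈ comps → x ∈ varsᶠ (distinct C) → relabel C x < blockSize
      relabel<blockSize {C} {x} C∈ x∈ = begin-strict
        relabel C x                          <⟨ variableIndex< (distinct C) x∈ ⟩
        length (varsᶠ (distinct C))          ≤⟨ length-varsᶠ (distinct C) ⟩
        length (distinct C) * maxArity       ≤⟨ *-monoˡ-≤ maxArity (length-distinct≤k C∈) ⟩
        k * maxArity                         <⟨ n<1+n (k * maxArity) ⟩
        blockSize                            ∎
        where open ≤-Reasoning

      shapeOf∈shapes : ∀ {C} → C ∈ comps → shapeOf C ∈ shapes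
      shapeOf∈shapes {C} C∈ = ∈-listsOfLength≤⁺ k shape⊆atomsBelow (begin
        length (shapeOf C)   ≡⟨ List.length-map (rename (relabel C)) (distinct C) ⟩
        length (distinct C)  ≤⟨ length-distinct≤k C∈ ⟩
        k                    ∎)
        where
        open ≤-Reasoning
        shape⊆atomsBelow : shapeOf C ⊆ atomsBelow blockSize
        shape⊆atomsBelow s∈ with ∈-map⁻ (rename (relabel C)) s∈
        ... | d , d∈ , refl = ∈-atomsBelow⁺ _ relabelled<blockSize
          where
          relabelled<blockSize : ∀ {y} → y ∈vars rename (relabel C) d → y < blockSize
          relabelled<blockSize y∈ with ∈vars-rename⁻ (relabel C) d y∈
          ... | x , x∈d , refl = relabel<blockSize C∈ (∈-varsᶠ⁺ d∈ x∈d)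

      toNormalForm-homomorphism : Homomorphism toNormalForm F normalForm
      toNormalForm-homomorphism {a} a∈F with hasVar? a
      ... | no ¬hasVar = subst (_∈ normalForm) (sym (rename-fixing a (⊥-elim ∘ no-var))) a∈normalForm
        where
        no-var : ∀ {x} → x ∈vars a → ⊥
        no-var x∈a = ¬hasVar (_ , ∈-varsᵛ⁺ (args a) x∈a)
        a∈normalForm : a ∈ normalForm
        a∈normalForm = ∈-++⁺ˡ (∈-filter⁺ (_∈ᵃ? F) (∈-atomsBelow⁺ a (⊥-elim ∘ no-var)) a∈F)
      ... | yes hasVar with components-cover varAtoms (∈-filter⁺ hasVar? a∈F hasVar)
      ...   | C , C∈ , a∈C = subst (_∈ normalForm) (sym via-shape) (∈-++⁺ʳ groundPart
                              (∈-concatMap⁺ block (lose shape∈shapesOf (∈-map⁺ _ (∈-map⁺ _ a∈distinct)))))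
        where
        a∈distinct : a ∈ distinct C
        a∈distinct = ∈-deduplicate⁺ _≟ᵃ_ a∈C
        shape∈shapesOf : shapeOf C ∈ shapesOf
        shape∈shapesOf = ∈-filter⁺ (_∈ˢ? map shapeOf comps) (shapeOf∈shapes C∈) (∈-map⁺ shapeOf C∈)
        via-shape : rename toNormalForm a ≡ rename (shift (shapeOf C)) (rename (relabel C) a)
        via-shape = trans (rename-cong a (toNormalForm-component C∈ ∘ ∈-varsᶠ⁺ a∈C))
                          (sym (rename-∘ (shift (shapeOf C)) (relabel C) a))

      fromNormalForm-inverts : ∀ {C x} → C ∈ comps → representative (shapeOf C) ≡ just C →
                               x ∈ varsᶠ (distinct C) → fromNormalForm (shift (shapeOf C) (relabel C x)) ≡ x
      fromNormalForm-inverts {C} {x} C∈ represented x∈ = begin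
        fromNormalForm (shift (shapeOf C) (relabel C x))  ≡⟨ fromNormalForm-shift (shapeOf∈shapes C∈) (relabel<blockSize C∈ x∈) ⟩
        decode (shapeOf C) (relabel C x)                  ≡⟨ cong (maybe (λ D → variableAt (distinct D) (relabel C x)) 0) represented ⟩
        variableAt (distinct C) (relabel C x)             ≡⟨ variableAt-variableIndex (distinct C) x∈ ⟩
        x                                                 ∎
        where open ≡-Reasoning

      fromNormalForm-homomorphism : Homomorphism fromNormalForm normalForm F
      fromNormalForm-homomorphism {g} g∈ with ∈-++⁻ groundPart g∈
      ... | inj₁ g∈groundPart with ∈-filter⁻ (_∈ᵃ? F) {xs = groundAtoms} g∈groundPart
      ...   | g∈groundAtoms , g∈F = subst (_∈ F) (sym (rename-fixing g no-var)) g∈F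
        where
        no-var : ∀ {x} → x ∈vars g → fromNormalForm x ≡ x
        no-var x∈g with () ← ∈-atomsBelow⁻ g∈groundAtoms x∈g
      fromNormalForm-homomorphism {g} g∈ | inj₂ g∈blocks
        with find (∈-concatMap⁻ block {xs = shapesOf} g∈blocks)
      ... | S , S∈shapesOf , g∈S with ∈-filter⁻ (_∈ˢ? map shapeOf comps) {xs = shapes} S∈shapesOf
      ... | _ , S-realised with representative-complete S-realised
      ... | C , represented with representative-sound represented
      ... | C∈ , refl with ∈-map⁻ (rename (shift (shapeOf C))) g∈S
      ... | s , s∈S , refl with ∈-map⁻ (rename (relabel C)) s∈S
      ... | d , d∈ , refl = subst (_∈ F) (sym back-to-d) d∈F
        where
        d∈F : d ∈ F
        d∈F = proj₁ (∈-varAtoms⁻ (components-⊆ varAtoms C∈ (distinct⊆component C d∈)))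
        back-to-d : rename fromNormalForm (rename (shift (shapeOf C)) (rename (relabel C) d)) ≡ d
        back-to-d = begin
          rename fromNormalForm (rename (shift (shapeOf C)) (rename (relabel C) d))
            ≡⟨ rename-∘ fromNormalForm (shift (shapeOf C)) (rename (relabel C) d) ⟩
          rename (fromNormalForm ∘ shift (shapeOf C)) (rename (relabel C) d)
            ≡⟨ rename-∘ (fromNormalForm ∘ shift (shapeOf C)) (relabel C) d ⟩
          rename (fromNormalForm ∘ shift (shapeOf C) ∘ relabel C) d
            ≡⟨ rename-fixing d (fromNormalForm-inverts C∈ represented ∘ ∈-varsᶠ⁺ d∈) ⟩
          d ∎
          where open ≡-Reasoning

      F≃normalForm : F ≃ normalForm
      F≃normalForm = homomorphic-equivalence toNormalForm-homomorphism fromNormalForm-homomorphism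

lemma3 : (np : ℕ) (ar : Fin np → ℕ) (nc : ℕ) (k : ℕ) →
    let open Signature np ar nc in
    Σ (List CSF) λ L →
      All (λ G → CWidth≤ G k) L ×
      ((F : CSF) → CWidth≤ F k → Any (λ G → F ≃ G) L)
lemma3 np ar nc k =
  candidates , candidates-cwidth ,
  λ F F-cwidth → Any.map (λ { refl → F≃normalForm F F-cwidth }) (normalForm∈candidates F)
  where
  open NormalForm np ar nc k
  open Canonical
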